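{- Let $(L;\wedge,\vee,^{\Delta},^{\nabla},0,1)$ be a weakly dicomplemented lattice, and let $D(L)=\{x\in L\mid x^{\nabla}=0\}$ and $\overline{D}(L)=\{x\in L\mid x^{\Delta}=1\}$. Then $(D(L);\vee,1)$ is a nearlattice and $(\overline{D}(L);\wedge,0)$ is a dual nearlattice. Moreover, if the lattice $L$ is distributive, then this nearlattice and this dual nearlattice are distributive.
   Context: A weakly dicomplemented lattice (WDL) is an algebra $(L;\wedge,\vee,^{\Delta},^{\nabla},0,1)$ of type $(2,2,1,1,0,0)$ such that $(L;\wedge,\vee,0,1)$ is a bounded lattice and, for all $x,y\in L$: $x^{\Delta\Delta}\le x$; $x\le y\Rightarrow y^{\Delta}\le x^{\Delta}$; $(x\wedge y)\vee(x\wedge y^{\Delta})=x$; $x^{\nabla\nabla}\ge x$; $x\le y\Rightarrow y^{\nabla}\le x^{\nabla}$; $(x\vee y)\wedge(x\vee y^{\nabla})=x$. A join semilattice with greatest element is an algebra $(A;\vee,1)$ with $\vee$ idempotent, commutative, associative and $x\vee 1=1$ for all $x$. A nearlattice is a join semilattice with greatest element $(A;\vee,1)$ such that for each $a\in A$ the principal filter $[a)=\{x\in A\mid a\le x\}$ is a bounded lattice; it is distributive if each such $[a)$ is a distributive lattice. A dual nearlattice is defined dually: a meet semilattice $(A;\wedge,0)$ with least element $0$ in which every principal ideal $(a]=\{x\in A\mid x\le a\}$ is a bounded lattice (distributive if each $(a]$ is distributive). -}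

module Defs where

open import Level using (Level; _⊔_; suc)
open import Data.Product using (Σ; _×_; _,_; proj₁)
open import Relation.Binary.PropositionalEquality using (_≡_)
open import Relation.Binary.Core using (Rel)
open import Relation.Binary.Structures using (IsEquivalence)
open import Algebra.Core using (Op₁; Op₂)
open import Algebra.Lattice.Structures using (IsLattice; IsDistributiveLattice)

record WDL (c : Level) : Set (suc c) where
  infixr 7 _∧_
  infixr 6 _∨_
  field
    Carrier   : Set c
    _∧_       : Op₂ Carrier
    _∨_       : Op₂ Carrier
    _ᐞ        : Op₁ Carrier
    _ᐁ        : Op₁ Carrier
    ⊥L        : Carrier
    ⊤L        : Carrier
    isLattice : IsLattice _≡_ _∨_ _∧_
    ⊥-least   : ∀ x → ⊥L ∧ x ≡ ⊥L
    ⊤-greatest : ∀ x → x ∧ ⊤L ≡ x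

  _≤_ : Carrier → Carrier → Set c
  x ≤ y = x ∧ y ≡ x

  field
    Δ-1 : ∀ x → ((x ᐞ) ᐞ) ≤ x
    Δ-2 : ∀ x y → x ≤ y → (y ᐞ) ≤ (x ᐞ)
    Δ-3 : ∀ x y → (x ∧ y) ∨ (x ∧ (y ᐞ)) ≡ x
    ∇-1 : ∀ x → x ≤ ((x ᐁ) ᐁ)
    ∇-2 : ∀ x y → x ≤ y → (y ᐁ) ≤ (x ᐁ)
    ∇-3 : ∀ x y → (x ∨ y) ∧ (x ∨ (y ᐁ)) ≡ x

  IsDistributive : Set c
  IsDistributive = IsDistributiveLattice _≡_ _∨_ _∧_

  D : Set c
  D = Σ Carrier λ x → (x ᐁ) ≡ ⊥L

  D̄ : Set c
  D̄ = Σ Carrier λ x → (x ᐞ) ≡ ⊤L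

  _≈D_ : Rel D c
  x ≈D y = proj₁ x ≡ proj₁ y

  _≈D̄_ : Rel D̄ c
  x ≈D̄ y = proj₁ x ≡ proj₁ y

module _ {a ℓ : Level} (A : Set a) (_≈_ : Rel A ℓ) where

  -- Every principal filter [a) = { x | a ≤ x } is a
  -- bounded lattice: a is its least element, 1 its greatest, binary joins
  -- in [a) are given by ∨ (they are least upper bounds in all of A, by the
  -- semilattice laws), and every two elements of [a) have a greatest lower
  -- bound in [a), provided by the field  meet .
  record IsNearlattice (_∨_ : Op₂ A) (𝟙 : A) : Set (a ⊔ ℓ) where
    field
      isEquivalence : IsEquivalence _≈_
      ∨-cong  : ∀ {x x′ y y′} → x ≈ x′ → y ≈ y′ → (x ∨ y) ≈ (x′ ∨ y′)
      ∨-idem  : ∀ x → (x ∨ x) ≈ x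
      ∨-comm  : ∀ x y → (x ∨ y) ≈ (y ∨ x)
      ∨-assoc : ∀ x y z → ((x ∨ y) ∨ z) ≈ (x ∨ (y ∨ z))
      ∨-𝟙     : ∀ x → (x ∨ 𝟙) ≈ 𝟙

    _≤_ : A → A → Set ℓ
    x ≤ y = (x ∨ y) ≈ y

    field
      meet      : ∀ p x y → p ≤ x → p ≤ y → A
      meet-in   : ∀ p x y (px : p ≤ x) (py : p ≤ y) → p ≤ meet p x y px py
      meet-≤ˡ   : ∀ p x y (px : p ≤ x) (py : p ≤ y) → meet p x y px py ≤ x
      meet-≤ʳ   : ∀ p x y (px : p ≤ x) (py : p ≤ y) → meet p x y px py ≤ y
      meet-glb  : ∀ p x y (px : p ≤ x) (py : p ≤ y) z → p ≤ z →
                  z ≤ x → z ≤ y → z ≤ meet p x y px py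

  record IsDistributiveNearlattice (_∨_ : Op₂ A) (𝟙 : A) : Set (a ⊔ ℓ) where
    field
      isNearlattice : IsNearlattice _∨_ 𝟙
    open IsNearlattice isNearlattice
    field
      distrib : ∀ p x y z (px : p ≤ x) (py : p ≤ y) (pz : p ≤ z)
                (pyz : p ≤ (y ∨ z)) →
                meet p x (y ∨ z) px pyz ≈ (meet p x y px py ∨ meet p x z px pz)

  -- Dual nearlattice: (A; ∧, 0) is a meet semilattice with least element 0,
  -- ordered by x ≤ y :⇔ x ∧ y ≈ x, and every principal ideal
  -- (a] = { x | x ≤ a } is a bounded lattice (0 least, a greatest, meets
  -- given by ∧, joins in (a] provided by the field  join ).
  record IsDualNearlattice (_∧_ : Op₂ A) (𝟘 : A) : Set (a ⊔ ℓ) where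
    field
      isEquivalence : IsEquivalence _≈_
      ∧-cong  : ∀ {x x′ y y′} → x ≈ x′ → y ≈ y′ → (x ∧ y) ≈ (x′ ∧ y′)
      ∧-idem  : ∀ x → (x ∧ x) ≈ x
      ∧-comm  : ∀ x y → (x ∧ y) ≈ (y ∧ x)
      ∧-assoc : ∀ x y z → ((x ∧ y) ∧ z) ≈ (x ∧ (y ∧ z))
      ∧-𝟘     : ∀ x → (x ∧ 𝟘) ≈ 𝟘

    _≤_ : A → A → Set ℓ
    x ≤ y = (x ∧ y) ≈ x

    field
      join      : ∀ p x y → x ≤ p → y ≤ p → A
      join-in   : ∀ p x y (xp : x ≤ p) (yp : y ≤ p) → join p x y xp yp ≤ p
      join-≥ˡ   : ∀ p x y (xp : x ≤ p) (yp : y ≤ p) → x ≤ join p x y xp yp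
      join-≥ʳ   : ∀ p x y (xp : x ≤ p) (yp : y ≤ p) → y ≤ join p x y xp yp
      join-lub  : ∀ p x y (xp : x ≤ p) (yp : y ≤ p) z → z ≤ p →
                  x ≤ z → y ≤ z → join p x y xp yp ≤ z

  record IsDistributiveDualNearlattice (_∧_ : Op₂ A) (𝟘 : A) : Set (a ⊔ ℓ) where
    field
      isDualNearlattice : IsDualNearlattice _∧_ 𝟘
    open IsDualNearlattice isDualNearlattice
    field
      distrib : ∀ p x y z (xp : x ≤ p) (yp : y ≤ p) (zp : z ≤ p)
                (yzp : (y ∧ z) ≤ p) →
                join p x (y ∧ z) xp yzp ≈ (join p x y xp yp ∧ join p x z xp zp)

module Submission where

-- ∇ is antitone, so D(L) is an up-set of L, and it contains 1 by the third ∇-axiom at (0, 1).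
-- In an up-set U of a bounded lattice, the filter [p) of any p ∈ U lies inside U, so it is
-- the lattice filter of L: U is a nearlattice under ∨ whose filter-meets are ∧, and it is
-- distributive when L is.  Dually, D̄(L) is an up-set of the order dual (L; ∨, ∧), and a
-- nearlattice read in the reversed order is a dual nearlattice.

open import Defs
open import Level using (Level)
open import Data.Product using (Σ; _×_; _,_; proj₁; proj₂)
open import Relation.Unary using (Pred)
open import Relation.Binary.Core using (Rel)
open import Relation.Binary.Structures using (IsEquivalence)
import Relation.Binary.Construct.On as On
open import Relation.Binary.PropositionalEquality as ≡
  using (_≡_; cong; cong₂; module ≡-Reasoning)
open import Algebra.Core using (Op₂)
open import Algebra.Lattice.Bundles using (Lattice)
open import Algebra.Lattice.Structures using (IsLattice; IsDistributiveLattice)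
import Algebra.Lattice.Properties.Lattice as LatticeProperties

module _ {a ℓ} {A : Set a} {_≈_ : Rel A ℓ} {_∙_ : Op₂ A} {e : A} where

  module _ (N : IsNearlattice A _≈_ _∙_ e) where
    open IsNearlattice N
    open IsEquivalence isEquivalence

    dual≤⇒≥ : ∀ {x y} → (x ∙ y) ≈ x → y ≤ x
    dual≤⇒≥ {x} {y} xy≈x = trans (∨-comm y x) xy≈x

    ≥⇒dual≤ : ∀ {x y} → y ≤ x → (x ∙ y) ≈ x
    ≥⇒dual≤ {x} {y} y≤x = trans (∨-comm x y) y≤x

    IsNearlattice⇒IsDualNearlattice : IsDualNearlattice A _≈_ _∙_ e
    IsNearlattice⇒IsDualNearlattice = record
      { isEquivalence = isEquivalence
      ; ∧-cong   = ∨-cong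
      ; ∧-idem   = ∨-idem
      ; ∧-comm   = ∨-comm
      ; ∧-assoc  = ∨-assoc
      ; ∧-𝟘      = ∨-𝟙
      ; join     = λ p x y xp yp → meet p x y (dual≤⇒≥ xp) (dual≤⇒≥ yp)
      ; join-in  = λ p x y xp yp → ≥⇒dual≤ (meet-in p x y (dual≤⇒≥ xp) (dual≤⇒≥ yp))
      ; join-≥ˡ  = λ p x y xp yp → ≥⇒dual≤ (meet-≤ˡ p x y (dual≤⇒≥ xp) (dual≤⇒≥ yp))
      ; join-≥ʳ  = λ p x y xp yp → ≥⇒dual≤ (meet-≤ʳ p x y (dual≤⇒≥ xp) (dual≤⇒≥ yp))
      ; join-lub = λ p x y xp yp z zp xz yz → ≥⇒dual≤
          (meet-glb p x y (dual≤⇒≥ xp) (dual≤⇒≥ yp) z (dual≤⇒≥ zp) (dual≤⇒≥ xz) (dual≤⇒≥ yz))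
      }

  IsDistributiveNearlattice⇒IsDistributiveDualNearlattice :
    IsDistributiveNearlattice A _≈_ _∙_ e → IsDistributiveDualNearlattice A _≈_ _∙_ e
  IsDistributiveNearlattice⇒IsDistributiveDualNearlattice N = record
    { isDualNearlattice = IsNearlattice⇒IsDualNearlattice isNearlattice
    ; distrib = λ p x y z xp yp zp yzp →
        distrib p x y z (dual≤⇒≥ isNearlattice xp) (dual≤⇒≥ isNearlattice yp)
                        (dual≤⇒≥ isNearlattice zp) (dual≤⇒≥ isNearlattice yzp)
    }
    where open IsDistributiveNearlattice N

module PropositionalLattice {a} {A : Set a} {_∨_ _∧_ : Op₂ A}
                            (isLattice : IsLattice _≡_ _∨_ _∧_) where

  open IsLattice isLattice
  open ≡-Reasoning

  lattice : Lattice a a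
  lattice = record { isLattice = isLattice }

  ∧≡⇒∨≡ : ∀ {x y} → x ∧ y ≡ x → x ∨ y ≡ y
  ∧≡⇒∨≡ {x} {y} x∧y≡x = begin
    x ∨ y        ≡⟨ cong (_∨ y) x∧y≡x ⟨
    (x ∧ y) ∨ y  ≡⟨ ∨-comm (x ∧ y) y ⟩
    y ∨ (x ∧ y)  ≡⟨ cong (y ∨_) (∧-comm x y) ⟩
    y ∨ (y ∧ x)  ≡⟨ ∨-absorbs-∧ y x ⟩
    y            ∎

  ∨≡⇒∧≡ : ∀ {x y} → x ∨ y ≡ y → x ∧ y ≡ x
  ∨≡⇒∧≡ {x} {y} x∨y≡y = ≡.trans (cong (x ∧_) (≡.sym x∨y≡y)) (∧-absorbs-∨ x y)

  ∧-greatest : ∀ {z x y} → z ∧ x ≡ z → z ∧ y ≡ z → z ∧ (x ∧ y) ≡ z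
  ∧-greatest {z} {x} {y} z∧x≡z z∧y≡z = begin
    z ∧ (x ∧ y)  ≡⟨ ∧-assoc z x y ⟨
    (z ∧ x) ∧ y  ≡⟨ cong (_∧ y) z∧x≡z ⟩
    z ∧ y        ≡⟨ z∧y≡z ⟩
    z            ∎

  ∨-∧-greatest : ∀ {z x y} → z ∨ x ≡ x → z ∨ y ≡ y → z ∨ (x ∧ y) ≡ x ∧ y
  ∨-∧-greatest z≤x z≤y = ∧≡⇒∨≡ (∧-greatest (∨≡⇒∧≡ z≤x) (∨≡⇒∧≡ z≤y))

  x∧y∨x≡x : ∀ x y → (x ∧ y) ∨ x ≡ x
  x∧y∨x≡x x y = ≡.trans (∨-comm (x ∧ y) x) (∨-absorbs-∧ x y)

  x∧y∨y≡y : ∀ x y → (x ∧ y) ∨ y ≡ y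
  x∧y∨y≡y x y = ≡.trans (cong (_∨ y) (∧-comm x y)) (x∧y∨x≡x y x)

module UpperSet {a ℓ} {A : Set a} {_∨_ _∧_ : Op₂ A} (isLattice : IsLattice _≡_ _∨_ _∧_)
                {⊤ : A} (x∨⊤≡⊤ : ∀ x → x ∨ ⊤ ≡ ⊤)
                (P : Pred A ℓ) (P-up : ∀ {x y} → x ∧ y ≡ x → P x → P y) where

  open IsLattice isLattice
  open PropositionalLattice isLattice
  open LatticeProperties lattice using (∨-idem)
  open import Algebra.Definitions {A = A} _≡_ using (_DistributesOverˡ_)

  U : Set _
  U = Σ A P

  _≈U_ : Rel U a
  u ≈U v = proj₁ u ≡ proj₁ v

  ∨-closed : ∀ x y → P x → P y → P (x ∨ y)
  ∨-closed x y Px _ = P-up (∧-absorbs-∨ x y) Px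

  _∨U_ : Op₂ U
  u ∨U v = proj₁ u ∨ proj₁ v , ∨-closed (proj₁ u) (proj₁ v) (proj₂ u) (proj₂ v)

  ∧-closed-above : ∀ {p x y} → p ∧ x ≡ p → p ∧ y ≡ p → P p → P (x ∧ y)
  ∧-closed-above p≤x p≤y = P-up (∧-greatest p≤x p≤y)

  meetAbove : (p u v : U) → (p ∨U u) ≈U u → (p ∨U v) ≈U v → U
  meetAbove p u v p≤u p≤v =
    proj₁ u ∧ proj₁ v , ∧-closed-above (∨≡⇒∧≡ p≤u) (∨≡⇒∧≡ p≤v) (proj₂ p)

  isNearlattice : (P⊤ : P ⊤) → IsNearlattice U _≈U_ _∨U_ (⊤ , P⊤)
  isNearlattice _ = record
    { isEquivalence = On.isEquivalence proj₁ ≡.isEquivalence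
    ; ∨-cong   = cong₂ _∨_
    ; ∨-idem   = λ u → ∨-idem (proj₁ u)
    ; ∨-comm   = λ u v → ∨-comm (proj₁ u) (proj₁ v)
    ; ∨-assoc  = λ u v w → ∨-assoc (proj₁ u) (proj₁ v) (proj₁ w)
    ; ∨-𝟙      = λ u → x∨⊤≡⊤ (proj₁ u)
    ; meet     = meetAbove
    ; meet-in  = λ _ _ _ p≤u p≤v → ∨-∧-greatest p≤u p≤v
    ; meet-≤ˡ  = λ _ u v _ _ → x∧y∨x≡x (proj₁ u) (proj₁ v)
    ; meet-≤ʳ  = λ _ u v _ _ → x∧y∨y≡y (proj₁ u) (proj₁ v)
    ; meet-glb = λ _ _ _ _ _ _ _ w≤u w≤v → ∨-∧-greatest w≤u w≤v
    }

  isDistributiveNearlattice : (P⊤ : P ⊤) → _∧_ DistributesOverˡ _∨_ →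
                              IsDistributiveNearlattice U _≈U_ _∨U_ (⊤ , P⊤)
  isDistributiveNearlattice P⊤ ∧-distribˡ-∨ = record
    { isNearlattice = isNearlattice P⊤
    ; distrib = λ _ u v w _ _ _ _ → ∧-distribˡ-∨ (proj₁ u) (proj₁ v) (proj₁ w)
    }

module WDLProperties {c} (L : WDL c) where

  open WDL L
  open IsLattice isLattice
  open PropositionalLattice isLattice
  open ≡-Reasoning

  Dense : Pred Carrier c
  Dense x = x ᐁ ≡ ⊥L

  DualDense : Pred Carrier c
  DualDense x = x ᐞ ≡ ⊤L

  ⊤∧x≡x : ∀ x → ⊤L ∧ x ≡ x
  ⊤∧x≡x x = ≡.trans (∧-comm ⊤L x) (⊤-greatest x)

  x∧⊥≡⊥ : ∀ x → x ∧ ⊥L ≡ ⊥L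
  x∧⊥≡⊥ x = ≡.trans (∧-comm x ⊥L) (⊥-least x)

  ⊥∨x≡x : ∀ x → ⊥L ∨ x ≡ x
  ⊥∨x≡x x = ∧≡⇒∨≡ (⊥-least x)

  x∨⊤≡⊤ : ∀ x → x ∨ ⊤L ≡ ⊤L
  x∨⊤≡⊤ x = ∧≡⇒∨≡ (⊤-greatest x)

  Dense-⊤ : Dense ⊤L
  Dense-⊤ = begin
    ⊤L ᐁ                       ≡⟨ ⊤∧x≡x (⊤L ᐁ) ⟨
    ⊤L ∧ ⊤L ᐁ                  ≡⟨ cong₂ _∧_ (⊥∨x≡x ⊤L) (⊥∨x≡x (⊤L ᐁ)) ⟨
    (⊥L ∨ ⊤L) ∧ (⊥L ∨ ⊤L ᐁ)    ≡⟨ ∇-3 ⊥L ⊤L ⟩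
    ⊥L                         ∎

  DualDense-⊥ : DualDense ⊥L
  DualDense-⊥ = begin
    ⊥L ᐞ                       ≡⟨ ⊥∨x≡x (⊥L ᐞ) ⟨
    ⊥L ∨ ⊥L ᐞ                  ≡⟨ cong₂ _∨_ (⊤∧x≡x ⊥L) (⊤∧x≡x (⊥L ᐞ)) ⟨
    (⊤L ∧ ⊥L) ∨ (⊤L ∧ ⊥L ᐞ)    ≡⟨ Δ-3 ⊤L ⊥L ⟩
    ⊤L                         ∎

  Dense-up : ∀ {x y} → x ≤ y → Dense x → Dense y
  Dense-up {x} {y} x≤y xᐁ≡⊥ = begin
    y ᐁ          ≡⟨ ∇-2 x y x≤y ⟨
    y ᐁ ∧ x ᐁ    ≡⟨ cong (y ᐁ ∧_) xᐁ≡⊥ ⟩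
    y ᐁ ∧ ⊥L     ≡⟨ x∧⊥≡⊥ (y ᐁ) ⟩
    ⊥L           ∎

  DualDense-down : ∀ {x y} → x ∨ y ≡ x → DualDense x → DualDense y
  DualDense-down {x} {y} y≤x xᐞ≡⊤ = begin
    y ᐞ          ≡⟨ ⊤∧x≡x (y ᐞ) ⟨
    ⊤L ∧ y ᐞ     ≡⟨ cong (_∧ y ᐞ) xᐞ≡⊤ ⟨
    x ᐞ ∧ y ᐞ    ≡⟨ Δ-2 y x (∨≡⇒∧≡ (≡.trans (∨-comm y x) y≤x)) ⟩
    x ᐞ          ≡⟨ xᐞ≡⊤ ⟩
    ⊤L           ∎

proposition2p8 : {c : Level} (L : WDL c) → let open WDL L in
    Σ (∀ x y → (x ᐁ) ≡ ⊥L → (y ᐁ) ≡ ⊥L → ((x ∨ y) ᐁ) ≡ ⊥L) λ ∨-closed →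
    Σ ((⊤L ᐁ) ≡ ⊥L) λ ⊤∈D →
    Σ (∀ x y → (x ᐞ) ≡ ⊤L → (y ᐞ) ≡ ⊤L → ((x ∧ y) ᐞ) ≡ ⊤L) λ ∧-closed →
    Σ ((⊥L ᐞ) ≡ ⊤L) λ ⊥∈D̄ →
    let _∨D_ : D → D → D
        _∨D_ = λ u v → (proj₁ u ∨ proj₁ v , ∨-closed (proj₁ u) (proj₁ v) (proj₂ u) (proj₂ v))
        _∧D̄_ : D̄ → D̄ → D̄
        _∧D̄_ = λ u v → (proj₁ u ∧ proj₁ v , ∧-closed (proj₁ u) (proj₁ v) (proj₂ u) (proj₂ v))
    in
    IsNearlattice D _≈D_ _∨D_ (⊤L , ⊤∈D)
    × IsDualNearlattice D̄ _≈D̄_ _∧D̄_ (⊥L , ⊥∈D̄)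
    × (IsDistributive →
         IsDistributiveNearlattice D _≈D_ _∨D_ (⊤L , ⊤∈D)
         × IsDistributiveDualNearlattice D̄ _≈D̄_ _∧D̄_ (⊥L , ⊥∈D̄))
proposition2p8 L =
  DL.∨-closed , Dense-⊤ , D̄L.∨-closed , DualDense-⊥ ,
  DL.isNearlattice Dense-⊤ ,
  IsNearlattice⇒IsDualNearlattice (D̄L.isNearlattice DualDense-⊥) ,
  λ distributive →
    DL.isDistributiveNearlattice Dense-⊤ (∧-distribˡ-∨ distributive) ,
    IsDistributiveNearlattice⇒IsDistributiveDualNearlattice
      (D̄L.isDistributiveNearlattice DualDense-⊥ (∨-distribˡ-∧ distributive))
  where
  open WDL L
  open WDLProperties L
  open IsDistributiveLattice using (∧-distribˡ-∨; ∨-distribˡ-∧)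
  open LatticeProperties (PropositionalLattice.lattice isLattice) using (∧-∨-isLattice)

  module DL = UpperSet isLattice x∨⊤≡⊤ Dense Dense-up
  module D̄L = UpperSet ∧-∨-isLattice x∧⊥≡⊥ DualDense DualDense-down
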